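{- Let $a$ be a positive integer. The minimum element of the set $\mathcal{L}_{2a-1,5}$ is $8a-4$.
   Context: For positive integers $n$, $r$ and an integer $b$, define $\mathcal{A}_{n,b}(r)=\left\{\sum_{i=1}^{r}b^{c_i}-r \;:\; \sum_{i=1}^{r}c_i=n,\ c_i\in\mathbb{N}=\{1,2,3,\dots\}\right\}$ and $\mathcal{L}_{n,b}=\bigcup_{r=1}^{n}\mathcal{A}_{n,b}(r)$. -}

module Defs where

open import Data.Nat using (ℕ; zero; suc; _≤_; _>_)
open import Data.Integer as ℤ using (ℤ; +_)
open import Data.List using (List; length; map)
open import Data.Nat.ListAction using (sum)
open import Data.List.Relation.Unary.All using (All)
open import Data.Product using (Σ; _×_)
open import Relation.Binary.PropositionalEquality using (_≡_)

_^ᶻ_ : ℤ → ℕ → ℤ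
b ^ᶻ zero = + 1
b ^ᶻ suc k = b ℤ.* (b ^ᶻ k)

sumᶻ : List ℤ → ℤ
sumᶻ Data.List.[] = + 0
sumᶻ (x Data.List.∷ xs) = x ℤ.+ sumᶻ xs

-- x ∈ A_{n,b}(r): there is a composition (c_1,...,c_r) of n into r positive parts
-- with x = Σ b^{c_i} - r
InA : ℕ → ℤ → ℕ → ℤ → Set
InA n b r x =
  Σ (List ℕ) λ cs →
    (length cs ≡ r) × (All (λ c → c > 0) cs) × (sum cs ≡ n) ×
    (x ≡ sumᶻ (map (λ c → b ^ᶻ c) cs) ℤ.- (+ r))

-- x ∈ L_{n,b} = ⋃_{r=1}^{n} A_{n,b}(r)
InL : ℕ → ℤ → ℤ → Set
InL n b x = Σ ℕ λ r → (1 ≤ r) × (r ≤ n) × InA n b r x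

{-# OPTIONS --safe #-}
module Submission where

-- Bernoulli's inequality (1 + m)^c ≥ 1 + m c bounds every part: Σ (1 + m)^{c_i} - r ≥ Σ m c_i = m n,
-- with equality for the composition of n into ones.  For base 5 and n = 2a - 1 this is 4(2a - 1) = 8a - 4.

open import Defs
open import Data.Nat using (ℕ; _∸_; _*_; _>_)
open import Data.Integer as ℤ using (ℤ; +_)
open import Data.Product using (_×_)
open import Data.Nat using (zero; suc; _+_; _≤_; _^_; s≤s; z≤n)
open import Data.Nat.Properties
open import Data.Integer.Properties using (pos-*; pos-+; m-n≡m⊖n; ⊖-≥)
import Data.Integer.Properties as ℤₚ
open import Data.List using ([]; _∷_; length; map; replicate)
open import Data.List.Properties using (length-replicate; map-replicate)
open import Data.List.Relation.Unary.All.Properties using (replicate⁺)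
open import Data.Nat.ListAction using (sum)
open import Data.Nat.Tactic.RingSolver using (solve-∀)
open import Data.Product using (_,_)
open import Relation.Binary.PropositionalEquality using (_≡_; refl; sym; trans; cong; cong₂; module ≡-Reasoning)

^ᶻ-pos : ∀ b c → (+ b) ^ᶻ c ≡ + (b ^ c)
^ᶻ-pos b zero    = refl
^ᶻ-pos b (suc c) = trans (cong ((+ b) ℤ.*_) (^ᶻ-pos b c)) (sym (pos-* b (b ^ c)))

sumᶻ-map-^ᶻ : ∀ b cs → sumᶻ (map (λ c → (+ b) ^ᶻ c) cs) ≡ + sum (map (b ^_) cs)
sumᶻ-map-^ᶻ b []       = refl
sumᶻ-map-^ᶻ b (c ∷ cs) =
  trans (cong₂ ℤ._+_ (^ᶻ-pos b c) (sumᶻ-map-^ᶻ b cs)) (sym (pos-+ (b ^ c) _))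

+m-+n≡+[m∸n] : ∀ m n → n ≤ m → + m ℤ.- + n ≡ + (m ∸ n)
+m-+n≡+[m∸n] m n n≤m = trans (m-n≡m⊖n m n) (⊖-≥ n≤m)

sum-replicate : ∀ n x → sum (replicate n x) ≡ n * x
sum-replicate zero    x = refl
sum-replicate (suc n) x = cong (_+_ x) (sum-replicate n x)

bernoulli : ∀ m c → m * c + 1 ≤ suc m ^ c
bernoulli m zero    = ≤-reflexive (cong (_+ 1) (*-zeroʳ m))
bernoulli m (suc c) = begin
  m * suc c + 1                ≡⟨ cong (_+ 1) (*-suc m c) ⟩
  m + m * c + 1                ≡⟨ +-assoc m (m * c) 1 ⟩
  m + (m * c + 1)              ≡⟨ +-comm m (m * c + 1) ⟩
  (m * c + 1) + m              ≤⟨ +-mono-≤ (bernoulli m c) (m≤m*n m (suc m ^ c) {{m^n≢0 (suc m) c}}) ⟩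
  suc m ^ c + m * suc m ^ c    ∎
  where open ≤-Reasoning

bernoulli-sum : ∀ m cs → m * sum cs + length cs ≤ sum (map (suc m ^_) cs)
bernoulli-sum m []       = ≤-reflexive (cong (_+ 0) (*-zeroʳ m))
bernoulli-sum m (c ∷ cs) = begin
  m * (c + sum cs) + suc (length cs)          ≡⟨ regroup m c (sum cs) (length cs) ⟩
  (m * c + 1) + (m * sum cs + length cs)      ≤⟨ +-mono-≤ (bernoulli m c) (bernoulli-sum m cs) ⟩
  suc m ^ c + sum (map (suc m ^_) cs)         ∎
  where
  open ≤-Reasoning
  regroup : ∀ m c s l → m * (c + s) + (1 + l) ≡ (m * c + 1) + (m * s + l)
  regroup = solve-∀

InA-lowerBound : ∀ {n m r x} → InA n (+ suc m) r x → + (m * n) ℤ.≤ x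
InA-lowerBound {m = m} (cs , refl , _ , refl , refl) = begin
  + (m * sum cs)                                      ≤⟨ ℤ.+≤+ (m+n≤o⇒m≤o∸n _ bound) ⟩
  + (S ∸ length cs)                                   ≡⟨ +m-+n≡+[m∸n] S (length cs) (m+n≤o⇒n≤o _ bound) ⟨
  + S ℤ.- + length cs                                 ≡⟨ cong (ℤ._- + length cs) (sumᶻ-map-^ᶻ (suc m) cs) ⟨
  sumᶻ (map (λ c → (+ suc m) ^ᶻ c) cs) ℤ.- + length cs  ∎
  where
  open ℤₚ.≤-Reasoning
  S = sum (map (suc m ^_) cs)
  bound : m * sum cs + length cs ≤ S
  bound = bernoulli-sum m cs

InA-ones : ∀ m n → InA n (+ suc m) n (+ (m * n))
InA-ones m n =
  replicate n 1 , length-replicate n , replicate⁺ n (s≤s z≤n) ,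
  trans (sum-replicate n 1) (*-identityʳ n) , sym value
  where
  open ≡-Reasoning
  sum-powers : sum (map (suc m ^_) (replicate n 1)) ≡ n * suc m
  sum-powers = begin
    sum (map (suc m ^_) (replicate n 1))  ≡⟨ cong sum (map-replicate (suc m ^_) n 1) ⟩
    sum (replicate n (suc m ^ 1))         ≡⟨ sum-replicate n (suc m ^ 1) ⟩
    n * suc m ^ 1                         ≡⟨ cong (n *_) (^-identityʳ (suc m)) ⟩
    n * suc m                             ∎
  value : sumᶻ (map (λ c → (+ suc m) ^ᶻ c) (replicate n 1)) ℤ.- + n ≡ + (m * n)
  value = begin
    sumᶻ (map (λ c → (+ suc m) ^ᶻ c) (replicate n 1)) ℤ.- + n
      ≡⟨ cong (ℤ._- + n) (sumᶻ-map-^ᶻ (suc m) (replicate n 1)) ⟩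
    + sum (map (suc m ^_) (replicate n 1)) ℤ.- + n
      ≡⟨ cong (λ s → + s ℤ.- + n) sum-powers ⟩
    + (n * suc m) ℤ.- + n
      ≡⟨ +m-+n≡+[m∸n] (n * suc m) n (m≤m*n n (suc m)) ⟩
    + (n * suc m ∸ n)
      ≡⟨ cong (λ k → + (k ∸ n)) (*-suc n m) ⟩
    + (n + n * m ∸ n)
      ≡⟨ cong +_ (trans (m+n∸m≡n n (n * m)) (*-comm n m)) ⟩
    + (m * n)
      ∎

InL-minimum : ∀ m n → 1 ≤ n →
  InL n (+ suc m) (+ (m * n)) × (∀ x → InL n (+ suc m) x → + (m * n) ℤ.≤ x)
InL-minimum m n 1≤n =
  (n , 1≤n , ≤-refl , InA-ones m n) , λ _ (_ , _ , _ , x∈A) → InA-lowerBound x∈A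

8*a∸4≡4*[2*a∸1] : ∀ a → 8 * a ∸ 4 ≡ 4 * (2 * a ∸ 1)
8*a∸4≡4*[2*a∸1] a = trans (cong (_∸ 4) (*-assoc 4 2 a)) (sym (*-distribˡ-∸ 4 (2 * a) 1))

a>0⇒2*a∸1≥1 : ∀ {a} → a > 0 → 1 ≤ 2 * a ∸ 1
a>0⇒2*a∸1≥1 a>0 = ∸-monoˡ-≤ 1 (*-monoʳ-≤ 2 a>0)

mainTheorem11 : (a : ℕ) → a > 0 →
    InL (2 * a ∸ 1) (+ 5) (+ (8 * a ∸ 4)) ×
    ((x : ℤ) → InL (2 * a ∸ 1) (+ 5) x → (+ (8 * a ∸ 4)) ℤ.≤ x)
mainTheorem11 a a>0 rewrite 8*a∸4≡4*[2*a∸1] a = InL-minimum 4 (2 * a ∸ 1) (a>0⇒2*a∸1≥1 a>0)
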